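{- Every finite type $\sigma$ is a strong retract of some finite type of the form $\tau\to0$: there are a finite type $\tau$ and closed terms $i:\sigma\to(\tau\to0)$ and $r:(\tau\to0)\to\sigma$, both strong, such that $\mathsf{H}\text{ - }\mathsf{HA}^\omega\vdash\forall^{\mathrm{Ext}}x:\sigma.\,r(ix)=_\sigma x$.
   Context: Finite types are generated by: $0$ is a type; if $\sigma,\tau$ are types, so are $\sigma\times\tau$ and $\sigma\to\tau$ ($\to$ associates to the right). $\mathsf{HA}^\omega$ is the many-sorted intuitionistic first-order theory whose sorts are the finite types. Its terms are built from variables and, for all types $\rho,\sigma,\tau$, the constants $\mathsf{k}:\rho\to\sigma\to\rho$, $\mathsf{s}:(\rho\to\sigma\to\tau)\to(\rho\to\sigma)\to(\rho\to\tau)$, $\mathsf{pair}:\sigma\to\tau\to\sigma\times\tau$, $\mathsf{fst}:\sigma\times\tau\to\sigma$, $\mathsf{snd}:\sigma\times\tau\to\tau$, $0:0$, $S:0\to0$, $\mathsf{R}:\sigma\to(0\to\sigma\to\sigma)\to0\to\sigma$, by application (associating to the left). Atomic formulas are $\bot$ and $s\equiv_\sigma t$. Axioms: $\equiv_\sigma$ is an equivalence relation; $x\equiv x'\to y\equiv y'\to xy\equiv x'y'$; $\mathsf{k}xy\equiv x$; $\mathsf{s}xyz\equiv xz(yz)$; $\mathsf{fst}(\mathsf{pair}\,xy)\equiv x$; $\mathsf{snd}(\mathsf{pair}\,xy)\equiv y$; $\mathsf{R}xy0\equiv x$; $\mathsf{R}xy(Sm)\equiv ym(\mathsf{R}xym)$;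 $Sx\equiv_0Sy\to x\equiv_0y$; $\neg(Sx\equiv_00)$; induction for all formulas. Surjective pairing is not assumed. $\mathsf{H}\text{ - }\mathsf{HA}^\omega$ extends the language with, for each type $\sigma$, a unary predicate $\mathrm{Ext}_\sigma$ and a binary predicate $=_\sigma$; $\forall^{\mathrm{Ext}}x:\sigma.\psi$ abbreviates $\forall x:\sigma(\mathrm{Ext}_\sigma(x)\to\psi)$. Its axioms are those of $\mathsf{HA}^\omega$, induction for all formulas of the extended language, and for all $\sigma,\tau$: $x=_0y\leftrightarrow x\equiv_0y$; $\forall x:0\,\mathrm{Ext}_0(x)$; $x=_{\sigma\times\tau}y\leftrightarrow(\mathsf{fst}\,x=_\sigma\mathsf{fst}\,y\wedge\mathsf{snd}\,x=_\tau\mathsf{snd}\,y)$; $\mathrm{Ext}_{\sigma\times\tau}(x)\leftrightarrow(\mathrm{Ext}_\sigma(\mathsf{fst}\,x)\wedge\mathrm{Ext}_\tau(\mathsf{snd}\,x))$; $f=_{\sigma\to\tau}g\leftrightarrow\forall^{\mathrm{Ext}}x:\sigma.fx=_\tau gx$; $\mathrm{Ext}_{\sigma\to\tau}(f)\to\mathrm{Ext}_\sigma(x)\to\mathrm{Ext}_\tau(fx)$; $x\equiv_\sigma y\to\mathrm{Ext}_\sigma(x)\to\mathrm{Ext}_\sigma(y)$; $\mathrm{Ext}(c)$ for each constant $c$. A closed term $t:\alpha\to\beta$ is called strong if $\mathsf{H}\text{ - }\mathsf{HA}^\omega\vdash\forall x,y:\alpha(\mathrm{Ext}_\alpha(x)\to\mathrm{Ext}_\alpha(y)\to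 x=_\alpha y\to tx=_\beta ty)$. A type $\alpha$ is a strong retract of $\beta$ if there are strong closed terms $i:\alpha\to\beta$, $r:\beta\to\alpha$ with $\mathsf{H}\text{ - }\mathsf{HA}^\omega\vdash\forall^{\mathrm{Ext}}x:\alpha.\,r(ix)=_\alpha x$. -}

module Defs where

open import Data.List using (List; []; _∷_; map)
open import Data.List.Membership.Propositional using (_∈_)
open import Data.Product using (Σ; _×_; _,_)

infixr 7 _⊗_
infixr 6 _⇒_

data Ty : Set where
  ι   : Ty                -- the base type 0
  _⊗_ : Ty → Ty → Ty
  _⇒_ : Ty → Ty → Ty

Ctx : Set
Ctx = List Ty

data Var : Ctx → Ty → Set where
  here  : ∀ {Γ σ} → Var (σ ∷ Γ) σ
  there : ∀ {Γ σ τ} → Var Γ σ → Var (τ ∷ Γ) σ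

infixl 9 _·_

data Tm (Γ : Ctx) : Ty → Set where
  var  : ∀ {σ} → Var Γ σ → Tm Γ σ
  𝐤    : ∀ {ρ σ} → Tm Γ (ρ ⇒ σ ⇒ ρ)
  𝐬    : ∀ {ρ σ τ} → Tm Γ ((ρ ⇒ σ ⇒ τ) ⇒ (ρ ⇒ σ) ⇒ (ρ ⇒ τ))
  pair : ∀ {σ τ} → Tm Γ (σ ⇒ τ ⇒ σ ⊗ τ)
  fst  : ∀ {σ τ} → Tm Γ (σ ⊗ τ ⇒ σ)
  snd  : ∀ {σ τ} → Tm Γ (σ ⊗ τ ⇒ τ)
  zer  : Tm Γ ι
  suc  : Tm Γ (ι ⇒ ι)
  rec  : ∀ {σ} → Tm Γ (σ ⇒ (ι ⇒ σ ⇒ σ) ⇒ ι ⇒ σ)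
  _·_  : ∀ {σ τ} → Tm Γ (σ ⇒ τ) → Tm Γ σ → Tm Γ τ

Ren : Ctx → Ctx → Set
Ren Γ Δ = ∀ {σ} → Var Γ σ → Var Δ σ

liftR : ∀ {Γ Δ τ} → Ren Γ Δ → Ren (τ ∷ Γ) (τ ∷ Δ)
liftR ρ here      = here
liftR ρ (there v) = there (ρ v)

renT : ∀ {Γ Δ σ} → Ren Γ Δ → Tm Γ σ → Tm Δ σ
renT ρ (var v) = var (ρ v)
renT ρ 𝐤 = 𝐤
renT ρ 𝐬 = 𝐬
renT ρ pair = pair
renT ρ fst = fst
renT ρ snd = snd
renT ρ zer = zer
renT ρ suc = suc
renT ρ rec = rec
renT ρ (t · u) = renT ρ t · renT ρ u

wkT : ∀ {Γ σ τ} → Tm Γ σ → Tm (τ ∷ Γ) σ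
wkT = renT there

Sub : Ctx → Ctx → Set
Sub Γ Δ = ∀ {σ} → Var Γ σ → Tm Δ σ

liftS : ∀ {Γ Δ τ} → Sub Γ Δ → Sub (τ ∷ Γ) (τ ∷ Δ)
liftS θ here      = var here
liftS θ (there v) = wkT (θ v)

subT : ∀ {Γ Δ σ} → Sub Γ Δ → Tm Γ σ → Tm Δ σ
subT θ (var v) = θ v
subT θ 𝐤 = 𝐤
subT θ 𝐬 = 𝐬
subT θ pair = pair
subT θ fst = fst
subT θ snd = snd
subT θ zer = zer
subT θ suc = suc
subT θ rec = rec
subT θ (t · u) = subT θ t · subT θ u

infixr 3 _⊃_
infixr 4 _∨'_
infixr 5 _∧'_
infix 6 _≡'_ _≐_

data Fm (Γ : Ctx) : Set where
  ⊥'   : Fm Γ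
  _≡'_ : ∀ {σ} → Tm Γ σ → Tm Γ σ → Fm Γ      -- intensional  s ≡_σ t
  Ext  : ∀ {σ} → Tm Γ σ → Fm Γ
  _≐_  : ∀ {σ} → Tm Γ σ → Tm Γ σ → Fm Γ       -- extensional s =_σ t
  _∧'_ : Fm Γ → Fm Γ → Fm Γ
  _∨'_ : Fm Γ → Fm Γ → Fm Γ
  _⊃_  : Fm Γ → Fm Γ → Fm Γ
  all  : (σ : Ty) → Fm (σ ∷ Γ) → Fm Γ
  ex   : (σ : Ty) → Fm (σ ∷ Γ) → Fm Γ

¬' : ∀ {Γ} → Fm Γ → Fm Γ
¬' φ = φ ⊃ ⊥'

infix 2 _⟺_
_⟺_ : ∀ {Γ} → Fm Γ → Fm Γ → Fm Γ
φ ⟺ ψ = (φ ⊃ ψ) ∧' (ψ ⊃ φ)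

renF : ∀ {Γ Δ} → Ren Γ Δ → Fm Γ → Fm Δ
renF ρ ⊥' = ⊥'
renF ρ (s ≡' t) = renT ρ s ≡' renT ρ t
renF ρ (Ext t) = Ext (renT ρ t)
renF ρ (s ≐ t) = renT ρ s ≐ renT ρ t
renF ρ (φ ∧' ψ) = renF ρ φ ∧' renF ρ ψ
renF ρ (φ ∨' ψ) = renF ρ φ ∨' renF ρ ψ
renF ρ (φ ⊃ ψ) = renF ρ φ ⊃ renF ρ ψ
renF ρ (all σ φ) = all σ (renF (liftR ρ) φ)
renF ρ (ex σ φ) = ex σ (renF (liftR ρ) φ)

wkF : ∀ {Γ τ} → Fm Γ → Fm (τ ∷ Γ)
wkF = renF there

subF : ∀ {Γ Δ} → Sub Γ Δ → Fm Γ → Fm Δ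
subF θ ⊥' = ⊥'
subF θ (s ≡' t) = subT θ s ≡' subT θ t
subF θ (Ext t) = Ext (subT θ t)
subF θ (s ≐ t) = subT θ s ≐ subT θ t
subF θ (φ ∧' ψ) = subF θ φ ∧' subF θ ψ
subF θ (φ ∨' ψ) = subF θ φ ∨' subF θ ψ
subF θ (φ ⊃ ψ) = subF θ φ ⊃ subF θ ψ
subF θ (all σ φ) = all σ (subF (liftS θ) φ)
subF θ (ex σ φ) = ex σ (subF (liftS θ) φ)

single : ∀ {Γ σ} → Tm Γ σ → Sub (σ ∷ Γ) Γ
single t here      = t
single t (there v) = var v

_[_] : ∀ {Γ σ} → Fm (σ ∷ Γ) → Tm Γ σ → Fm Γ
φ [ t ] = subF (single t) φ

succSub : ∀ {Γ} → Sub (ι ∷ Γ) (ι ∷ Γ)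
succSub here      = suc · var here
succSub (there v) = var (there v)

-- Axiom schemes with free variables are given as rules
-- for arbitrary terms (equivalent to their universal closures).
infix 1 _⨾_⊢_
data _⨾_⊢_ (Γ : Ctx) (Δ : List (Fm Γ)) : Fm Γ → Set where
  hyp  : ∀ {φ} → φ ∈ Δ → Γ ⨾ Δ ⊢ φ
  ⊥E   : ∀ {φ} → Γ ⨾ Δ ⊢ ⊥' → Γ ⨾ Δ ⊢ φ
  ⊃I   : ∀ {φ ψ} → Γ ⨾ φ ∷ Δ ⊢ ψ → Γ ⨾ Δ ⊢ φ ⊃ ψ
  ⊃E   : ∀ {φ ψ} → Γ ⨾ Δ ⊢ φ ⊃ ψ → Γ ⨾ Δ ⊢ φ → Γ ⨾ Δ ⊢ ψ
  ∧I   : ∀ {φ ψ} → Γ ⨾ Δ ⊢ φ → Γ ⨾ Δ ⊢ ψ → Γ ⨾ Δ ⊢ φ ∧' ψ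
  ∧E₁  : ∀ {φ ψ} → Γ ⨾ Δ ⊢ φ ∧' ψ → Γ ⨾ Δ ⊢ φ
  ∧E₂  : ∀ {φ ψ} → Γ ⨾ Δ ⊢ φ ∧' ψ → Γ ⨾ Δ ⊢ ψ
  ∨I₁  : ∀ {φ ψ} → Γ ⨾ Δ ⊢ φ → Γ ⨾ Δ ⊢ φ ∨' ψ
  ∨I₂  : ∀ {φ ψ} → Γ ⨾ Δ ⊢ ψ → Γ ⨾ Δ ⊢ φ ∨' ψ
  ∨E   : ∀ {φ ψ χ} → Γ ⨾ Δ ⊢ φ ∨' ψ → Γ ⨾ φ ∷ Δ ⊢ χ → Γ ⨾ ψ ∷ Δ ⊢ χ
       → Γ ⨾ Δ ⊢ χ
  ∀I   : ∀ {σ φ} → (σ ∷ Γ) ⨾ map wkF Δ ⊢ φ → Γ ⨾ Δ ⊢ all σ φ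
  ∀E   : ∀ {σ φ} → Γ ⨾ Δ ⊢ all σ φ → (t : Tm Γ σ) → Γ ⨾ Δ ⊢ φ [ t ]
  ∃I   : ∀ {σ φ} → (t : Tm Γ σ) → Γ ⨾ Δ ⊢ φ [ t ] → Γ ⨾ Δ ⊢ ex σ φ
  ∃E   : ∀ {σ φ ψ} → Γ ⨾ Δ ⊢ ex σ φ → (σ ∷ Γ) ⨾ φ ∷ map wkF Δ ⊢ wkF ψ
       → Γ ⨾ Δ ⊢ ψ
  ≡-refl  : ∀ {σ} (x : Tm Γ σ) → Γ ⨾ Δ ⊢ x ≡' x
  ≡-sym   : ∀ {σ} (x y : Tm Γ σ) → Γ ⨾ Δ ⊢ x ≡' y ⊃ y ≡' x
  ≡-trans : ∀ {σ} (x y z : Tm Γ σ) → Γ ⨾ Δ ⊢ x ≡' y ⊃ y ≡' z ⊃ x ≡' z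
  ≡-app   : ∀ {σ τ} (x x' : Tm Γ (σ ⇒ τ)) (y y' : Tm Γ σ)
          → Γ ⨾ Δ ⊢ x ≡' x' ⊃ y ≡' y' ⊃ (x · y) ≡' (x' · y')
  ax-k    : ∀ {ρ σ} (x : Tm Γ ρ) (y : Tm Γ σ) → Γ ⨾ Δ ⊢ 𝐤 · x · y ≡' x
  ax-s    : ∀ {ρ σ τ} (x : Tm Γ (ρ ⇒ σ ⇒ τ)) (y : Tm Γ (ρ ⇒ σ)) (z : Tm Γ ρ)
          → Γ ⨾ Δ ⊢ 𝐬 · x · y · z ≡' x · z · (y · z)
  ax-fst  : ∀ {σ τ} (x : Tm Γ σ) (y : Tm Γ τ) → Γ ⨾ Δ ⊢ fst · (pair · x · y) ≡' x
  ax-snd  : ∀ {σ τ} (x : Tm Γ σ) (y : Tm Γ τ) → Γ ⨾ Δ ⊢ snd · (pair · x · y) ≡' y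
  ax-R0   : ∀ {σ} (x : Tm Γ σ) (y : Tm Γ (ι ⇒ σ ⇒ σ))
          → Γ ⨾ Δ ⊢ rec · x · y · zer ≡' x
  ax-RS   : ∀ {σ} (x : Tm Γ σ) (y : Tm Γ (ι ⇒ σ ⇒ σ)) (m : Tm Γ ι)
          → Γ ⨾ Δ ⊢ rec · x · y · (suc · m) ≡' y · m · (rec · x · y · m)
  ax-Sinj : ∀ (x y : Tm Γ ι) → Γ ⨾ Δ ⊢ (suc · x) ≡' (suc · y) ⊃ x ≡' y
  ax-S≢0  : ∀ (x : Tm Γ ι) → Γ ⨾ Δ ⊢ ¬' ((suc · x) ≡' zer)
  -- induction for all formulas of the extended language
  ind     : ∀ (φ : Fm (ι ∷ Γ))
          → Γ ⨾ Δ ⊢ φ [ zer ]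
          → Γ ⨾ Δ ⊢ all ι (φ ⊃ subF succSub φ)
          → Γ ⨾ Δ ⊢ all ι φ
  eq-0    : ∀ (x y : Tm Γ ι) → Γ ⨾ Δ ⊢ (x ≐ y) ⟺ (x ≡' y)
  ext-0   : ∀ (x : Tm Γ ι) → Γ ⨾ Δ ⊢ Ext x
  eq-×    : ∀ {σ τ} (x y : Tm Γ (σ ⊗ τ))
          → Γ ⨾ Δ ⊢ (x ≐ y) ⟺ ((fst · x ≐ fst · y) ∧' (snd · x ≐ snd · y))
  ext-×   : ∀ {σ τ} (x : Tm Γ (σ ⊗ τ))
          → Γ ⨾ Δ ⊢ Ext x ⟺ (Ext (fst · x) ∧' Ext (snd · x))
  eq-→    : ∀ {σ τ} (f g : Tm Γ (σ ⇒ τ))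
          → Γ ⨾ Δ ⊢ (f ≐ g) ⟺ all σ (Ext (var here) ⊃ (wkT f · var here) ≐ (wkT g · var here))
  ext-app : ∀ {σ τ} (f : Tm Γ (σ ⇒ τ)) (x : Tm Γ σ)
          → Γ ⨾ Δ ⊢ Ext f ⊃ Ext x ⊃ Ext (f · x)
  ext-≡   : ∀ {σ} (x y : Tm Γ σ) → Γ ⨾ Δ ⊢ x ≡' y ⊃ Ext x ⊃ Ext y
  ext-k    : ∀ {ρ σ} → Γ ⨾ Δ ⊢ Ext (𝐤 {ρ = ρ} {σ = σ})
  ext-s    : ∀ {ρ σ τ} → Γ ⨾ Δ ⊢ Ext (𝐬 {ρ = ρ} {σ = σ} {τ = τ})
  ext-pair : ∀ {σ τ} → Γ ⨾ Δ ⊢ Ext (pair {σ = σ} {τ = τ})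
  ext-fst  : ∀ {σ τ} → Γ ⨾ Δ ⊢ Ext (fst {σ = σ} {τ = τ})
  ext-snd  : ∀ {σ τ} → Γ ⨾ Δ ⊢ Ext (snd {σ = σ} {τ = τ})
  ext-zer  : Γ ⨾ Δ ⊢ Ext zer
  ext-suc  : Γ ⨾ Δ ⊢ Ext suc
  ext-rec  : ∀ {σ} → Γ ⨾ Δ ⊢ Ext (rec {σ = σ})

⊢H : Fm [] → Set
⊢H φ = [] ⨾ [] ⊢ φ

Closed : Ty → Set
Closed σ = Tm [] σ

Strong : ∀ {α β} → Closed (α ⇒ β) → Set
Strong {α} t =
  ⊢H (all α (all α
       (Ext (var (there here)) ⊃ Ext (var here) ⊃
        var (there here) ≐ var here ⊃
        (renT (λ ()) t · var (there here)) ≐ (renT (λ ()) t · var here))))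

StrongRetract : Ty → Ty → Set
StrongRetract α β =
  Σ (Closed (α ⇒ β)) λ i → Σ (Closed (β ⇒ α)) λ r →
    Strong i × Strong r ×
    ⊢H (all α (Ext (var here) ⊃
         (renT (λ ()) r · (renT (λ ()) i · var here)) ≐ var here))

{-# OPTIONS --safe #-}
module Submission where

-- Induction on σ, writing σ ◁ ρ for "σ is a strong retract of ρ" and 0 for a closed
-- inhabitant of a type:
--   ι ◁ ι ⇒ ι  via  x ↦ λ_. x  and  f ↦ f 0;
--   if σ₂ ◁ β ⇒ ι then σ₁ ⇒ σ₂ ◁ σ₁ ⊗ β ⇒ ι  via  f ↦ λp. i₂ (f (fst p)) (snd p)
--   and  h ↦ λx. r₂ (h ∘ pair x);
--   if σ₁ ◁ α ⇒ ι and σ₂ ◁ β ⇒ ι then σ₁ ⊗ σ₂ ◁ α ⊕ β ⇒ ι, where α ⊕ β = (ι ⇒ ι ⇒ ι) ⊗ (α ⊗ β),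
--   via  p ↦ λq. fst q (i₁ (fst p) (fst (snd q))) (i₂ (snd p) (snd (snd q)))  and
--   h ↦ ⟨r₁ (h ∘ inj₁), r₂ (h ∘ inj₂)⟩  with  inj₁ a = ⟨k, ⟨a, 0⟩⟩,  inj₂ b = ⟨k I, ⟨0, b⟩⟩:
--   the selector fst q decides which of the two embedded functions is read.
-- Strength and r ∘ i = id are checked pointwise from the combinator equations and the
-- extensionality axioms. Pointwise arguments take place under a binder, so everything
-- is proved as an admissible rule valid in every context.

open import Defs
open import Data.List using (List; []; _∷_; map)
open import Data.List.Membership.Propositional using (_∈_)
open import Data.List.Membership.Propositional.Properties using (∈-map⁺; ∈-map⁻)
open import Data.List.Relation.Unary.Any using (here; there)
open import Data.Product using (Σ; _,_)
open import Relation.Binary.PropositionalEquality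
  using (_≡_; refl; sym; trans; cong; cong₂; subst; subst₂)

private variable
  Γ Γ' Γ₁ Γ₂ Γ₃ : Ctx
  Δ : List (Fm Γ)
  σ τ α β δ σ₁ σ₂ : Ty

infix 4 _≗ᵛ_
_≗ᵛ_ : {T : Ty → Set} → (∀ {σ} → Var Γ σ → T σ) → (∀ {σ} → Var Γ σ → T σ) → Set
f ≗ᵛ g = ∀ {σ} (v : Var _ σ) → f {σ} v ≡ g v

renT-cong : {ρ ρ' : Ren Γ Γ'} → ρ ≗ᵛ ρ' → (t : Tm Γ σ) → renT ρ t ≡ renT ρ' t
renT-cong e (var v) = cong var (e v)
renT-cong e 𝐤 = refl
renT-cong e 𝐬 = refl
renT-cong e pair = refl
renT-cong e fst = refl
renT-cong e snd = refl
renT-cong e zer = refl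
renT-cong e suc = refl
renT-cong e rec = refl
renT-cong e (t · u) = cong₂ _·_ (renT-cong e t) (renT-cong e u)

module _ {ρ : Ren Γ₂ Γ₃} {ρ' : Ren Γ₁ Γ₂} {ρ'' : Ren Γ₁ Γ₃} where

  liftR-liftR : (λ v → ρ (ρ' v)) ≗ᵛ ρ'' → (λ v → liftR {τ = τ} ρ (liftR ρ' v)) ≗ᵛ liftR ρ''
  liftR-liftR e here = refl
  liftR-liftR e (there v) = cong there (e v)

  renT-renT : (λ v → ρ (ρ' v)) ≗ᵛ ρ'' → (t : Tm Γ₁ σ) → renT ρ (renT ρ' t) ≡ renT ρ'' t
  renT-renT e (var v) = cong var (e v)
  renT-renT e 𝐤 = refl
  renT-renT e 𝐬 = refl
  renT-renT e pair = refl
  renT-renT e fst = refl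
  renT-renT e snd = refl
  renT-renT e zer = refl
  renT-renT e suc = refl
  renT-renT e rec = refl
  renT-renT e (t · u) = cong₂ _·_ (renT-renT e t) (renT-renT e u)

renF-renF : {ρ : Ren Γ₂ Γ₃} {ρ' : Ren Γ₁ Γ₂} {ρ'' : Ren Γ₁ Γ₃} →
            (λ v → ρ (ρ' v)) ≗ᵛ ρ'' → (φ : Fm Γ₁) → renF ρ (renF ρ' φ) ≡ renF ρ'' φ
renF-renF e ⊥' = refl
renF-renF e (s ≡' t) = cong₂ _≡'_ (renT-renT e s) (renT-renT e t)
renF-renF e (Ext t) = cong Ext (renT-renT e t)
renF-renF e (s ≐ t) = cong₂ _≐_ (renT-renT e s) (renT-renT e t)
renF-renF e (φ ∧' ψ) = cong₂ _∧'_ (renF-renF e φ) (renF-renF e ψ)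
renF-renF e (φ ∨' ψ) = cong₂ _∨'_ (renF-renF e φ) (renF-renF e ψ)
renF-renF e (φ ⊃ ψ) = cong₂ _⊃_ (renF-renF e φ) (renF-renF e ψ)
renF-renF e (all σ φ) = cong (all σ) (renF-renF (liftR-liftR e) φ)
renF-renF e (ex σ φ) = cong (ex σ) (renF-renF (liftR-liftR e) φ)

module _ {θ : Sub Γ₂ Γ₃} {ρ : Ren Γ₁ Γ₂} {θ' : Sub Γ₁ Γ₃} where

  liftS-liftR : (λ v → θ (ρ v)) ≗ᵛ θ' → (λ v → liftS {τ = τ} θ (liftR ρ v)) ≗ᵛ liftS θ'
  liftS-liftR e here = refl
  liftS-liftR e (there v) = cong wkT (e v)

  subT-renT : (λ v → θ (ρ v)) ≗ᵛ θ' → (t : Tm Γ₁ σ) → subT θ (renT ρ t) ≡ subT θ' t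
  subT-renT e (var v) = e v
  subT-renT e 𝐤 = refl
  subT-renT e 𝐬 = refl
  subT-renT e pair = refl
  subT-renT e fst = refl
  subT-renT e snd = refl
  subT-renT e zer = refl
  subT-renT e suc = refl
  subT-renT e rec = refl
  subT-renT e (t · u) = cong₂ _·_ (subT-renT e t) (subT-renT e u)

subF-renF : {θ : Sub Γ₂ Γ₃} {ρ : Ren Γ₁ Γ₂} {θ' : Sub Γ₁ Γ₃} →
            (λ v → θ (ρ v)) ≗ᵛ θ' → (φ : Fm Γ₁) → subF θ (renF ρ φ) ≡ subF θ' φ
subF-renF e ⊥' = refl
subF-renF e (s ≡' t) = cong₂ _≡'_ (subT-renT e s) (subT-renT e t)
subF-renF e (Ext t) = cong Ext (subT-renT e t)
subF-renF e (s ≐ t) = cong₂ _≐_ (subT-renT e s) (subT-renT e t)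
subF-renF e (φ ∧' ψ) = cong₂ _∧'_ (subF-renF e φ) (subF-renF e ψ)
subF-renF e (φ ∨' ψ) = cong₂ _∨'_ (subF-renF e φ) (subF-renF e ψ)
subF-renF e (φ ⊃ ψ) = cong₂ _⊃_ (subF-renF e φ) (subF-renF e ψ)
subF-renF e (all σ φ) = cong (all σ) (subF-renF (liftS-liftR e) φ)
subF-renF e (ex σ φ) = cong (ex σ) (subF-renF (liftS-liftR e) φ)

module _ {ρ : Ren Γ₂ Γ₃} {θ : Sub Γ₁ Γ₂} {θ' : Sub Γ₁ Γ₃} where

  liftR-liftS : (λ v → renT ρ (θ v)) ≗ᵛ θ' → (λ v → renT (liftR {τ = τ} ρ) (liftS θ v)) ≗ᵛ liftS θ'
  liftR-liftS e here = refl
  liftR-liftS e (there v) =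
    trans (renT-renT (λ _ → refl) (θ v)) (trans (sym (renT-renT (λ _ → refl) (θ v))) (cong wkT (e v)))

  renT-subT : (λ v → renT ρ (θ v)) ≗ᵛ θ' → (t : Tm Γ₁ σ) → renT ρ (subT θ t) ≡ subT θ' t
  renT-subT e (var v) = e v
  renT-subT e 𝐤 = refl
  renT-subT e 𝐬 = refl
  renT-subT e pair = refl
  renT-subT e fst = refl
  renT-subT e snd = refl
  renT-subT e zer = refl
  renT-subT e suc = refl
  renT-subT e rec = refl
  renT-subT e (t · u) = cong₂ _·_ (renT-subT e t) (renT-subT e u)

renF-subF : {ρ : Ren Γ₂ Γ₃} {θ : Sub Γ₁ Γ₂} {θ' : Sub Γ₁ Γ₃} →
            (λ v → renT ρ (θ v)) ≗ᵛ θ' → (φ : Fm Γ₁) → renF ρ (subF θ φ) ≡ subF θ' φ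
renF-subF e ⊥' = refl
renF-subF e (s ≡' t) = cong₂ _≡'_ (renT-subT e s) (renT-subT e t)
renF-subF e (Ext t) = cong Ext (renT-subT e t)
renF-subF e (s ≐ t) = cong₂ _≐_ (renT-subT e s) (renT-subT e t)
renF-subF e (φ ∧' ψ) = cong₂ _∧'_ (renF-subF e φ) (renF-subF e ψ)
renF-subF e (φ ∨' ψ) = cong₂ _∨'_ (renF-subF e φ) (renF-subF e ψ)
renF-subF e (φ ⊃ ψ) = cong₂ _⊃_ (renF-subF e φ) (renF-subF e ψ)
renF-subF e (all σ φ) = cong (all σ) (renF-subF (liftR-liftS e) φ)
renF-subF e (ex σ φ) = cong (ex σ) (renF-subF (liftR-liftS e) φ)

subT-var : (t : Tm Γ σ) → subT var t ≡ t
subT-var (var v) = refl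
subT-var 𝐤 = refl
subT-var 𝐬 = refl
subT-var pair = refl
subT-var fst = refl
subT-var snd = refl
subT-var zer = refl
subT-var suc = refl
subT-var rec = refl
subT-var (t · u) = cong₂ _·_ (subT-var t) (subT-var u)

subT-single-wkT : (x : Tm Γ σ) (t : Tm Γ τ) → subT (single x) (wkT t) ≡ t
subT-single-wkT x t = trans (subT-renT (λ _ → refl) t) (subT-var t)

renT-liftR-wkT : (ρ : Ren Γ Γ') (t : Tm Γ σ) → renT (liftR {τ = τ} ρ) (wkT t) ≡ wkT (renT ρ t)
renT-liftR-wkT ρ t = trans (renT-renT (λ _ → refl) t) (sym (renT-renT (λ _ → refl) t))

renF-liftR-wkF : (ρ : Ren Γ Γ') (φ : Fm Γ) → renF (liftR {τ = τ} ρ) (wkF φ) ≡ wkF (renF ρ φ)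
renF-liftR-wkF ρ φ = trans (renF-renF (λ _ → refl) φ) (sym (renF-renF (λ _ → refl) φ))

renF-[] : (ρ : Ren Γ Γ') (t : Tm Γ σ) (φ : Fm (σ ∷ Γ)) →
          renF (liftR ρ) φ [ renT ρ t ] ≡ renF ρ (φ [ t ])
renF-[] ρ t φ = trans (subF-renF e φ) (sym (renF-subF (λ _ → refl) φ))
  where
  e : (λ v → single (renT ρ t) (liftR ρ v)) ≗ᵛ (λ v → renT ρ (single t v))
  e here = refl
  e (there v) = refl

renF-succSub : (ρ : Ren Γ Γ') (φ : Fm (ι ∷ Γ)) →
               renF (liftR ρ) (subF succSub φ) ≡ subF succSub (renF (liftR ρ) φ)
renF-succSub ρ φ = trans (renF-subF (λ _ → refl) φ) (sym (subF-renF e φ))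
  where
  e : (λ v → succSub (liftR ρ v)) ≗ᵛ (λ v → renT (liftR ρ) (succSub v))
  e here = refl
  e (there v) = refl

infix 4 _⊆[_]_
_⊆[_]_ : List (Fm Γ) → Ren Γ Γ' → List (Fm Γ') → Set
Δ ⊆[ ρ ] Δ' = ∀ {ψ} → ψ ∈ Δ → renF ρ ψ ∈ Δ'

module _ {ρ : Ren Γ Γ'} {Δ : List (Fm Γ)} {Δ' : List (Fm Γ')} where

  ⊆-∷ : (φ : Fm Γ) → Δ ⊆[ ρ ] Δ' → φ ∷ Δ ⊆[ ρ ] renF ρ φ ∷ Δ'
  ⊆-∷ φ inc (here refl) = here refl
  ⊆-∷ φ inc (there p) = there (inc p)

  ⊆-wkF : Δ ⊆[ ρ ] Δ' → map wkF Δ ⊆[ liftR {τ = τ} ρ ] map wkF Δ'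
  ⊆-wkF inc p with ∈-map⁻ wkF p
  ... | χ , q , refl = subst (_∈ _) (sym (renF-liftR-wkF ρ χ)) (∈-map⁺ wkF (inc q))

⊢-ren : {Δ' : List (Fm Γ')} {φ : Fm Γ} (ρ : Ren Γ Γ') → Δ ⊆[ ρ ] Δ' → Γ ⨾ Δ ⊢ φ → Γ' ⨾ Δ' ⊢ renF ρ φ
⊢-ren ρ inc (hyp p) = hyp (inc p)
⊢-ren ρ inc (⊥E d) = ⊥E (⊢-ren ρ inc d)
⊢-ren ρ inc (⊃I {φ = φ} d) = ⊃I (⊢-ren ρ (⊆-∷ φ inc) d)
⊢-ren ρ inc (⊃E d e) = ⊃E (⊢-ren ρ inc d) (⊢-ren ρ inc e)
⊢-ren ρ inc (∧I d e) = ∧I (⊢-ren ρ inc d) (⊢-ren ρ inc e)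
⊢-ren ρ inc (∧E₁ d) = ∧E₁ (⊢-ren ρ inc d)
⊢-ren ρ inc (∧E₂ d) = ∧E₂ (⊢-ren ρ inc d)
⊢-ren ρ inc (∨I₁ d) = ∨I₁ (⊢-ren ρ inc d)
⊢-ren ρ inc (∨I₂ d) = ∨I₂ (⊢-ren ρ inc d)
⊢-ren ρ inc (∨E {φ = φ} {ψ = ψ} d e f) =
  ∨E (⊢-ren ρ inc d) (⊢-ren ρ (⊆-∷ φ inc) e) (⊢-ren ρ (⊆-∷ ψ inc) f)
⊢-ren ρ inc (∀I d) = ∀I (⊢-ren (liftR ρ) (⊆-wkF inc) d)
⊢-ren ρ inc (∀E {φ = φ} d t) = subst (_ ⨾ _ ⊢_) (renF-[] ρ t φ) (∀E (⊢-ren ρ inc d) (renT ρ t))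
⊢-ren ρ inc (∃I {φ = φ} t d) = ∃I (renT ρ t) (subst (_ ⨾ _ ⊢_) (sym (renF-[] ρ t φ)) (⊢-ren ρ inc d))
⊢-ren ρ inc (∃E {φ = φ} {ψ = ψ} d e) =
  ∃E (⊢-ren ρ inc d) (subst (_ ⨾ _ ⊢_) (renF-liftR-wkF ρ ψ) (⊢-ren (liftR ρ) (⊆-∷ φ (⊆-wkF inc)) e))
⊢-ren ρ inc (≡-refl x) = ≡-refl _
⊢-ren ρ inc (≡-sym x y) = ≡-sym _ _
⊢-ren ρ inc (≡-trans x y z) = ≡-trans _ _ _
⊢-ren ρ inc (≡-app x x' y y') = ≡-app _ _ _ _
⊢-ren ρ inc (ax-k x y) = ax-k _ _
⊢-ren ρ inc (ax-s x y z) = ax-s _ _ _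
⊢-ren ρ inc (ax-fst x y) = ax-fst _ _
⊢-ren ρ inc (ax-snd x y) = ax-snd _ _
⊢-ren ρ inc (ax-R0 x y) = ax-R0 _ _
⊢-ren ρ inc (ax-RS x y m) = ax-RS _ _ _
⊢-ren ρ inc (ax-Sinj x y) = ax-Sinj _ _
⊢-ren ρ inc (ax-S≢0 x) = ax-S≢0 _
⊢-ren ρ inc (ind φ d e) =
  ind (renF (liftR ρ) φ)
      (subst (_ ⨾ _ ⊢_) (sym (renF-[] ρ zer φ)) (⊢-ren ρ inc d))
      (subst (λ χ → _ ⨾ _ ⊢ all ι (renF (liftR ρ) φ ⊃ χ)) (renF-succSub ρ φ) (⊢-ren ρ inc e))
⊢-ren ρ inc (eq-0 x y) = eq-0 _ _
⊢-ren ρ inc (ext-0 x) = ext-0 _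
⊢-ren ρ inc (eq-× x y) = eq-× _ _
⊢-ren ρ inc (ext-× x) = ext-× _
⊢-ren {Δ' = Δ'} ρ inc (eq-→ {σ = σ} f g) =
  subst₂ (λ f' g' → _ ⨾ Δ' ⊢ (renT ρ f ≐ renT ρ g) ⟺ all σ (Ext (var here) ⊃ f' · var here ≐ g' · var here))
    (sym (renT-liftR-wkT ρ f)) (sym (renT-liftR-wkT ρ g)) (eq-→ (renT ρ f) (renT ρ g))
⊢-ren ρ inc (ext-app f x) = ext-app _ _
⊢-ren ρ inc (ext-≡ x y) = ext-≡ _ _
⊢-ren ρ inc ext-k = ext-k
⊢-ren ρ inc ext-s = ext-s
⊢-ren ρ inc ext-pair = ext-pair
⊢-ren ρ inc ext-fst = ext-fst
⊢-ren ρ inc ext-snd = ext-snd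
⊢-ren ρ inc ext-zer = ext-zer
⊢-ren ρ inc ext-suc = ext-suc
⊢-ren ρ inc ext-rec = ext-rec

⊢-wk : {φ : Fm Γ} (ψ : Fm (σ ∷ Γ)) → Γ ⨾ Δ ⊢ φ → (σ ∷ Γ) ⨾ ψ ∷ map wkF Δ ⊢ wkF φ
⊢-wk ψ = ⊢-ren there (λ p → there (∈-map⁺ wkF p))

hyp₀ : {φ : Fm Γ} → Γ ⨾ φ ∷ Δ ⊢ φ
hyp₀ = hyp (here refl)

module _ {Γ : Ctx} {Δ : List (Fm Γ)} where

  ≡'-sym : {x y : Tm Γ σ} → Γ ⨾ Δ ⊢ x ≡' y → Γ ⨾ Δ ⊢ y ≡' x
  ≡'-sym d = ⊃E (≡-sym _ _) d

  ≡'-trans : {x y z : Tm Γ σ} → Γ ⨾ Δ ⊢ x ≡' y → Γ ⨾ Δ ⊢ y ≡' z → Γ ⨾ Δ ⊢ x ≡' z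
  ≡'-trans d e = ⊃E (⊃E (≡-trans _ _ _) d) e

  ·-cong : {f g : Tm Γ (σ ⇒ τ)} {x y : Tm Γ σ} → Γ ⨾ Δ ⊢ f ≡' g → Γ ⨾ Δ ⊢ x ≡' y → Γ ⨾ Δ ⊢ f · x ≡' g · y
  ·-cong d e = ⊃E (⊃E (≡-app _ _ _ _) d) e

  ·-congˡ : {f g : Tm Γ (σ ⇒ τ)} {x : Tm Γ σ} → Γ ⨾ Δ ⊢ f ≡' g → Γ ⨾ Δ ⊢ f · x ≡' g · x
  ·-congˡ d = ·-cong d (≡-refl _)

  ·-congʳ : {f : Tm Γ (σ ⇒ τ)} {x y : Tm Γ σ} → Γ ⨾ Δ ⊢ x ≡' y → Γ ⨾ Δ ⊢ f · x ≡' f · y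
  ·-congʳ = ·-cong (≡-refl _)

  Ext-· : {f : Tm Γ (σ ⇒ τ)} {x : Tm Γ σ} → Γ ⨾ Δ ⊢ Ext f → Γ ⨾ Δ ⊢ Ext x → Γ ⨾ Δ ⊢ Ext (f · x)
  Ext-· d e = ⊃E (⊃E (ext-app _ _) d) e

  Ext-fst : {p : Tm Γ (σ ⊗ τ)} → Γ ⨾ Δ ⊢ Ext p → Γ ⨾ Δ ⊢ Ext (fst · p)
  Ext-fst d = ∧E₁ (⊃E (∧E₁ (ext-× _)) d)

  Ext-snd : {p : Tm Γ (σ ⊗ τ)} → Γ ⨾ Δ ⊢ Ext p → Γ ⨾ Δ ⊢ Ext (snd · p)
  Ext-snd d = ∧E₂ (⊃E (∧E₁ (ext-× _)) d)

  ≐⇒≡'ι : {x y : Tm Γ ι} → Γ ⨾ Δ ⊢ x ≐ y → Γ ⨾ Δ ⊢ x ≡' y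
  ≐⇒≡'ι d = ⊃E (∧E₁ (eq-0 _ _)) d

  ≡'⇒≐ι : {x y : Tm Γ ι} → Γ ⨾ Δ ⊢ x ≡' y → Γ ⨾ Δ ⊢ x ≐ y
  ≡'⇒≐ι d = ⊃E (∧E₂ (eq-0 _ _)) d

  ≐-fst : {p q : Tm Γ (σ ⊗ τ)} → Γ ⨾ Δ ⊢ p ≐ q → Γ ⨾ Δ ⊢ fst · p ≐ fst · q
  ≐-fst d = ∧E₁ (⊃E (∧E₁ (eq-× _ _)) d)

  ≐-snd : {p q : Tm Γ (σ ⊗ τ)} → Γ ⨾ Δ ⊢ p ≐ q → Γ ⨾ Δ ⊢ snd · p ≐ snd · q
  ≐-snd d = ∧E₂ (⊃E (∧E₁ (eq-× _ _)) d)

  ≐-pair : {p q : Tm Γ (σ ⊗ τ)} → Γ ⨾ Δ ⊢ fst · p ≐ fst · q → Γ ⨾ Δ ⊢ snd · p ≐ snd · q → Γ ⨾ Δ ⊢ p ≐ q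
  ≐-pair d e = ⊃E (∧E₂ (eq-× _ _)) (∧I d e)

  ≐-app : {f g : Tm Γ (σ ⇒ τ)} {x : Tm Γ σ} → Γ ⨾ Δ ⊢ f ≐ g → Γ ⨾ Δ ⊢ Ext x → Γ ⨾ Δ ⊢ f · x ≐ g · x
  ≐-app {f = f} {g} {x} d e =
    ⊃E (subst₂ (λ f' g' → Γ ⨾ Δ ⊢ Ext x ⊃ f' · x ≐ g' · x) (subT-single-wkT x f) (subT-single-wkT x g)
          (∀E (⊃E (∧E₁ (eq-→ f g)) d) x)) e

  ≐-ext : {f g : Tm Γ (σ ⇒ τ)} →
          (σ ∷ Γ) ⨾ Ext (var here) ∷ map wkF Δ ⊢ wkT f · var here ≐ wkT g · var here → Γ ⨾ Δ ⊢ f ≐ g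
  ≐-ext d = ⊃E (∧E₂ (eq-→ _ _)) (∀I (⊃I d))

≐-trans : ∀ σ {x y z : Tm Γ σ} → Γ ⨾ Δ ⊢ x ≐ y → Γ ⨾ Δ ⊢ y ≐ z → Γ ⨾ Δ ⊢ x ≐ z
≐-trans ι d e = ≡'⇒≐ι (≡'-trans (≐⇒≡'ι d) (≐⇒≡'ι e))
≐-trans (σ ⊗ τ) d e = ≐-pair (≐-trans σ (≐-fst d) (≐-fst e)) (≐-trans τ (≐-snd d) (≐-snd e))
≐-trans (σ ⇒ τ) d e = ≐-ext (≐-trans τ (≐-app (⊢-wk _ d) hyp₀) (≐-app (⊢-wk _ e) hyp₀))

≡'⇒≐ : ∀ σ {x y : Tm Γ σ} → Γ ⨾ Δ ⊢ x ≡' y → Γ ⨾ Δ ⊢ x ≐ y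
≡'⇒≐ ι d = ≡'⇒≐ι d
≡'⇒≐ (σ ⊗ τ) d = ≐-pair (≡'⇒≐ σ (·-congʳ d)) (≡'⇒≐ τ (·-congʳ d))
≡'⇒≐ (σ ⇒ τ) d = ≐-ext (≡'⇒≐ τ (·-congˡ (⊢-wk _ d)))

≐-resp-≡' : ∀ σ {x x' y y' : Tm Γ σ} →
            Γ ⨾ Δ ⊢ x ≡' x' → Γ ⨾ Δ ⊢ x' ≐ y' → Γ ⨾ Δ ⊢ y ≡' y' → Γ ⨾ Δ ⊢ x ≐ y
≐-resp-≡' σ d e f = ≐-trans σ (≡'⇒≐ σ d) (≐-trans σ e (≡'⇒≐ σ (≡'-sym f)))

#0 : Tm (σ ∷ Γ) σ
#0 = var here

#1 : Tm (τ ∷ σ ∷ Γ) σ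
#1 = var (there here)

#2 : Tm (α ∷ τ ∷ σ ∷ Γ) σ
#2 = var (there (there here))

#3 : Tm (β ∷ α ∷ τ ∷ σ ∷ Γ) σ
#3 = var (there (there (there here)))

#4 : Tm (δ ∷ β ∷ α ∷ τ ∷ σ ∷ Γ) σ
#4 = var (there (there (there (there here))))

𝐈 : Tm Γ (σ ⇒ σ)
𝐈 {σ = σ} = 𝐬 {ρ = σ} {σ = σ ⇒ σ} · 𝐤 · 𝐤

𝐈-β : (u : Tm Γ σ) → Γ ⨾ Δ ⊢ 𝐈 · u ≡' u
𝐈-β u = ≡'-trans (ax-s _ _ _) (ax-k _ _)

lam : Tm (σ ∷ Γ) τ → Tm Γ (σ ⇒ τ)
lam (var here) = 𝐈
lam (var (there v)) = 𝐤 · var v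
lam 𝐤 = 𝐤 · 𝐤
lam 𝐬 = 𝐤 · 𝐬
lam pair = 𝐤 · pair
lam fst = 𝐤 · fst
lam snd = 𝐤 · snd
lam zer = 𝐤 · zer
lam suc = 𝐤 · suc
lam rec = 𝐤 · rec
lam (t · u) = 𝐬 · lam t · lam u

ε : Sub [] Γ
ε ()

infixl 5 _▸_
_▸_ : Sub Γ Γ' → Tm Γ' σ → Sub (σ ∷ Γ) Γ'
(θ ▸ u) here = u
(θ ▸ u) (there v) = θ v

lam-β : (θ : Sub Γ Γ') (t : Tm (σ ∷ Γ) τ) (u : Tm Γ' σ) → Γ' ⨾ Δ ⊢ subT θ (lam t) · u ≡' subT (θ ▸ u) t
lam-β θ (var here) u = 𝐈-β u
lam-β θ (var (there v)) u = ax-k _ _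
lam-β θ 𝐤 u = ax-k _ _
lam-β θ 𝐬 u = ax-k _ _
lam-β θ pair u = ax-k _ _
lam-β θ fst u = ax-k _ _
lam-β θ snd u = ax-k _ _
lam-β θ zer u = ax-k _ _
lam-β θ suc u = ax-k _ _
lam-β θ rec u = ax-k _ _
lam-β θ (t · t') u = ≡'-trans (ax-s _ _ _) (·-cong (lam-β θ t u) (lam-β θ t' u))

lam²-β : (θ : Sub Γ Γ') (t : Tm (τ ∷ σ ∷ Γ) δ) (u : Tm Γ' σ) (v : Tm Γ' τ) →
         Γ' ⨾ Δ ⊢ subT θ (lam (lam t)) · u · v ≡' subT (θ ▸ u ▸ v) t
lam²-β θ t u v = ≡'-trans (·-congˡ (lam-β θ (lam t) u)) (lam-β (θ ▸ u) t v)

⌜_⌝ : Closed σ → Tm Γ σ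
⌜ c ⌝ = renT (λ ()) c

renT-⌜⌝ : (ρ : Ren Γ Γ') (c : Closed σ) → renT ρ ⌜ c ⌝ ≡ ⌜ c ⌝
renT-⌜⌝ ρ c = renT-renT (λ ()) c

Ext-⌜⌝ : (c : Closed σ) → Γ ⨾ Δ ⊢ Ext ⌜ c ⌝
Ext-⌜⌝ (var ())
Ext-⌜⌝ 𝐤 = ext-k
Ext-⌜⌝ 𝐬 = ext-s
Ext-⌜⌝ pair = ext-pair
Ext-⌜⌝ fst = ext-fst
Ext-⌜⌝ snd = ext-snd
Ext-⌜⌝ zer = ext-zer
Ext-⌜⌝ suc = ext-suc
Ext-⌜⌝ rec = ext-rec
Ext-⌜⌝ (t · u) = Ext-· (Ext-⌜⌝ t) (Ext-⌜⌝ u)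

inhabitant : (σ : Ty) → Closed σ
inhabitant ι = zer
inhabitant (σ ⊗ τ) = pair · inhabitant σ · inhabitant τ
inhabitant (σ ⇒ τ) = 𝐤 · inhabitant τ

𝐁 : Closed ((β ⇒ δ) ⇒ (α ⇒ β) ⇒ α ⇒ δ)
𝐁 = lam (lam (lam (#2 · (#1 · #0))))

𝐁-β : (f : Tm Γ (β ⇒ δ)) (g : Tm Γ (α ⇒ β)) (x : Tm Γ α) → Γ ⨾ Δ ⊢ ⌜ 𝐁 ⌝ · f · g · x ≡' f · (g · x)
𝐁-β f g x = ≡'-trans (·-congˡ (·-congˡ (lam-β ε (lam (lam body)) f))) (lam²-β (ε ▸ f) body g x)
  where
  body : Tm (α ∷ (α ⇒ β) ∷ (β ⇒ δ) ∷ []) δ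
  body = #2 · (#1 · #0)

Ext-∘ : {f : Tm Γ (β ⇒ δ)} {g : Tm Γ (α ⇒ β)} →
        Γ ⨾ Δ ⊢ Ext f → Γ ⨾ Δ ⊢ Ext g → Γ ⨾ Δ ⊢ Ext (⌜ 𝐁 ⌝ · f · g)
Ext-∘ d e = Ext-· (Ext-· (Ext-⌜⌝ 𝐁) d) e

∘-congˡ : ∀ δ {f f' : Tm Γ (β ⇒ δ)} {g : Tm Γ (α ⇒ β)} →
          Γ ⨾ Δ ⊢ f ≐ f' → Γ ⨾ Δ ⊢ Ext g → Γ ⨾ Δ ⊢ ⌜ 𝐁 ⌝ · f · g ≐ ⌜ 𝐁 ⌝ · f' · g
∘-congˡ δ d e = ≐-ext (≐-resp-≡' δ (𝐁-β _ _ _) (≐-app (⊢-wk _ d) (Ext-· (⊢-wk _ e) hyp₀)) (𝐁-β _ _ _))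

UniformlyStrong : Closed (α ⇒ β) → Set
UniformlyStrong {α} c = ∀ {Γ Δ} {x y : Tm Γ α} →
  Γ ⨾ Δ ⊢ Ext x → Γ ⨾ Δ ⊢ Ext y → Γ ⨾ Δ ⊢ x ≐ y → Γ ⨾ Δ ⊢ ⌜ c ⌝ · x ≐ ⌜ c ⌝ · y

-- For an abstract closed c, wkT ⌜ c ⌝ and ⌜ c ⌝ are only propositionally equal.
UniformlyStrong-wk : {c : Closed (α ⇒ β)} → UniformlyStrong c → {x y : Tm (τ ∷ Γ) α} →
  (τ ∷ Γ) ⨾ Δ ⊢ Ext x → (τ ∷ Γ) ⨾ Δ ⊢ Ext y → (τ ∷ Γ) ⨾ Δ ⊢ x ≐ y →
  (τ ∷ Γ) ⨾ Δ ⊢ wkT ⌜ c ⌝ · x ≐ wkT ⌜ c ⌝ · y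
UniformlyStrong-wk {c = c} s {x} {y} eˣ eʸ d =
  subst (λ C → _ ⨾ _ ⊢ C · x ≐ C · y) (sym (renT-⌜⌝ there c)) (s eˣ eʸ d)

-- Strong refers to its own absurd renaming, which agrees with that of ⌜_⌝ only pointwise.
UniformlyStrong⇒Strong : (c : Closed (α ⇒ β)) → UniformlyStrong c → Strong c
UniformlyStrong⇒Strong c s = ∀I (∀I (⊃I (⊃I (⊃I
  (subst (λ C → _ ⨾ _ ⊢ C · var (there here) ≐ C · var here) (renT-cong (λ ()) c)
    (s (hyp (there (there (here refl)))) (hyp (there (here refl))) hyp₀))))))

record Retract (σ α : Ty) : Set where
  field
    i : Closed (σ ⇒ α)
    r : Closed (α ⇒ σ)
    i-strong : UniformlyStrong i
    r-strong : UniformlyStrong r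
    r∘i≐id : ∀ {Γ Δ} {x : Tm Γ σ} → Γ ⨾ Δ ⊢ Ext x → Γ ⨾ Δ ⊢ ⌜ r ⌝ · (⌜ i ⌝ · x) ≐ x

  r-inverts-i : {h : Tm Γ α} {x : Tm Γ σ} →
                Γ ⨾ Δ ⊢ Ext h → Γ ⨾ Δ ⊢ Ext x → Γ ⨾ Δ ⊢ h ≐ ⌜ i ⌝ · x → Γ ⨾ Δ ⊢ ⌜ r ⌝ · h ≐ x
  r-inverts-i eh eˣ d = ≐-trans σ (r-strong eh (Ext-· (Ext-⌜⌝ i) eˣ) d) (r∘i≐id eˣ)

  r-inverts-i-wk : {h : Tm (τ ∷ Γ) α} {x : Tm (τ ∷ Γ) σ} →
                   (τ ∷ Γ) ⨾ Δ ⊢ Ext h → (τ ∷ Γ) ⨾ Δ ⊢ Ext x → (τ ∷ Γ) ⨾ Δ ⊢ h ≐ wkT ⌜ i ⌝ · x →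
                   (τ ∷ Γ) ⨾ Δ ⊢ wkT ⌜ r ⌝ · h ≐ x
  r-inverts-i-wk {h = h} {x} eh eˣ d =
    subst (λ R → _ ⨾ _ ⊢ R · h ≐ x) (sym (renT-⌜⌝ there r))
      (r-inverts-i eh eˣ (subst (λ I → _ ⨾ _ ⊢ h ≐ I · x) (renT-⌜⌝ there i) d))

Retract⇒StrongRetract : Retract σ α → StrongRetract σ α
Retract⇒StrongRetract R =
  i , r , UniformlyStrong⇒Strong i i-strong , UniformlyStrong⇒Strong r r-strong ,
  ∀I (⊃I (subst₂ (λ R' I' → _ ⨾ _ ⊢ R' · (I' · var here) ≐ var here)
                 (renT-cong (λ ()) r) (renT-cong (λ ()) i) (r∘i≐id hyp₀)))
  where open Retract R


ι-retract : Retract ι (ι ⇒ ι)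
ι-retract = record
  { i = 𝐤 ; r = at0 ; i-strong = i-strong ; r-strong = r-strong ; r∘i≐id = λ _ → r∘i≐id }
  where
  at0 : Closed ((ι ⇒ ι) ⇒ ι)
  at0 = lam (#0 · zer)

  at0-β : (f : Tm Γ (ι ⇒ ι)) → Γ ⨾ Δ ⊢ ⌜ at0 ⌝ · f ≡' f · zer
  at0-β = lam-β ε (#0 · zer)

  i-strong : UniformlyStrong {ι} {ι ⇒ ι} 𝐤
  i-strong _ _ d = ≐-ext (≐-resp-≡' ι (ax-k _ _) (⊢-wk _ d) (ax-k _ _))

  r-strong : UniformlyStrong at0
  r-strong _ _ d = ≐-resp-≡' ι (at0-β _) (≐-app d (ext-0 zer)) (at0-β _)

  r∘i≐id : {x : Tm Γ ι} → Γ ⨾ Δ ⊢ ⌜ at0 ⌝ · (𝐤 · x) ≐ x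
  r∘i≐id = ≡'⇒≐ι (≡'-trans (at0-β _) (ax-k _ _))

-- Each construction is a substitution instance of an abstraction of a fixed body, so
-- renaming ⌜ sec⇒ i₂ ⌝ (as under a binder) is definitionally sec⇒ of the renamed ⌜ i₂ ⌝.
sec⇒ : Tm Γ (τ ⇒ β ⇒ δ) → Tm Γ ((α ⇒ τ) ⇒ α ⊗ β ⇒ δ)
sec⇒ I = subT (ε ▸ I) (lam (lam (#2 · (#1 · (fst · #0)) · (snd · #0))))

sec⇒-β : (I : Tm Γ (τ ⇒ β ⇒ δ)) (f : Tm Γ (α ⇒ τ)) (p : Tm Γ (α ⊗ β)) →
         Γ ⨾ Δ ⊢ sec⇒ I · f · p ≡' I · (f · (fst · p)) · (snd · p)
sec⇒-β I = lam²-β (ε ▸ I) (#2 · (#1 · (fst · #0)) · (snd · #0))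

ret⇒ : Tm Γ ((β ⇒ δ) ⇒ τ) → Tm Γ ((α ⊗ β ⇒ δ) ⇒ α ⇒ τ)
ret⇒ R = subT (ε ▸ R) (lam (lam (#2 · (⌜ 𝐁 ⌝ · #1 · (pair · #0)))))

ret⇒-β : (R : Tm Γ ((β ⇒ δ) ⇒ τ)) (h : Tm Γ (α ⊗ β ⇒ δ)) (x : Tm Γ α) →
         Γ ⨾ Δ ⊢ ret⇒ R · h · x ≡' R · (⌜ 𝐁 ⌝ · h · (pair · x))
ret⇒-β R = lam²-β (ε ▸ R) (#2 · (⌜ 𝐁 ⌝ · #1 · (pair · #0)))

sec⇒-∘-pair : ∀ δ (I : Tm Γ (τ ⇒ β ⇒ δ)) (f : Tm Γ (α ⇒ τ)) (x : Tm Γ α) →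
              Γ ⨾ Δ ⊢ ⌜ 𝐁 ⌝ · (sec⇒ I · f) · (pair · x) ≐ I · (f · x)
sec⇒-∘-pair δ I f x = ≐-ext (≡'⇒≐ δ
  (≡'-trans (𝐁-β _ _ _) (≡'-trans (sec⇒-β _ _ _)
    (·-cong (·-congʳ (·-congʳ (ax-fst _ _))) (ax-snd _ _)))))

⇒-retract : (σ₁ : Ty) → Retract σ₂ (β ⇒ ι) → Retract (σ₁ ⇒ σ₂) (σ₁ ⊗ β ⇒ ι)
⇒-retract {σ₂} σ₁ R = record
  { i = sec⇒ i₂ ; r = ret⇒ r₂ ; i-strong = i-strong ; r-strong = r-strong ; r∘i≐id = r∘i≐id }
  where
  open Retract R using (r-inverts-i-wk)
    renaming (i to i₂; r to r₂; i-strong to i₂-strong; r-strong to r₂-strong)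

  i-strong : UniformlyStrong (sec⇒ {α = σ₁} i₂)
  i-strong ef ef' d = ≐-ext (≐-resp-≡' ι (sec⇒-β _ _ _)
    (≐-app (UniformlyStrong-wk i₂-strong (Ext-· (⊢-wk _ ef) (Ext-fst hyp₀))
                                         (Ext-· (⊢-wk _ ef') (Ext-fst hyp₀))
                                         (≐-app (⊢-wk _ d) (Ext-fst hyp₀)))
           (Ext-snd hyp₀))
    (sec⇒-β _ _ _))

  r-strong : UniformlyStrong (ret⇒ {α = σ₁} r₂)
  r-strong eh eh' d = ≐-ext (≐-resp-≡' σ₂ (ret⇒-β _ _ _)
    (UniformlyStrong-wk r₂-strong (Ext-∘ (⊢-wk _ eh) (Ext-· ext-pair hyp₀))
                                  (Ext-∘ (⊢-wk _ eh') (Ext-· ext-pair hyp₀))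
                                  (∘-congˡ ι (⊢-wk _ d) (Ext-· ext-pair hyp₀)))
    (ret⇒-β _ _ _))

  r∘i≐id : {f : Tm Γ (σ₁ ⇒ σ₂)} → Γ ⨾ Δ ⊢ Ext f → Γ ⨾ Δ ⊢ ⌜ ret⇒ r₂ ⌝ · (⌜ sec⇒ i₂ ⌝ · f) ≐ f
  r∘i≐id ef = ≐-ext (≐-trans σ₂ (≡'⇒≐ σ₂ (ret⇒-β _ _ _))
    (r-inverts-i-wk
      (Ext-∘ (⊢-wk _ (Ext-· (Ext-⌜⌝ (sec⇒ i₂)) ef)) (Ext-· ext-pair hyp₀))
      (Ext-· (⊢-wk _ ef) hyp₀)
      (sec⇒-∘-pair ι _ _ _)))

infixr 7 _⊕_
_⊕_ : Ty → Ty → Ty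
α ⊕ β = (ι ⇒ ι ⇒ ι) ⊗ (α ⊗ β)

inj₁ : Tm Γ β → Tm Γ (α ⇒ α ⊕ β)
inj₁ D = subT (ε ▸ D) (lam (pair · 𝐤 · (pair · #0 · #1)))

inj₂ : Tm Γ α → Tm Γ (β ⇒ α ⊕ β)
inj₂ D = subT (ε ▸ D) (lam (pair · (𝐤 · 𝐈) · (pair · #1 · #0)))

sec⊗ : Tm Γ (σ₁ ⇒ α ⇒ ι) → Tm Γ (σ₂ ⇒ β ⇒ ι) → Tm Γ (σ₁ ⊗ σ₂ ⇒ α ⊕ β ⇒ ι)
sec⊗ I₁ I₂ = subT (ε ▸ I₁ ▸ I₂)
  (lam (lam (fst · #0 · (#3 · (fst · #1) · (fst · (snd · #0))) · (#2 · (snd · #1) · (snd · (snd · #0))))))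

sec⊗-β : (I₁ : Tm Γ (σ₁ ⇒ α ⇒ ι)) (I₂ : Tm Γ (σ₂ ⇒ β ⇒ ι))
         (p : Tm Γ (σ₁ ⊗ σ₂)) (q : Tm Γ (α ⊕ β)) →
         Γ ⨾ Δ ⊢ sec⊗ I₁ I₂ · p · q
               ≡' fst · q · (I₁ · (fst · p) · (fst · (snd · q))) · (I₂ · (snd · p) · (snd · (snd · q)))
sec⊗-β I₁ I₂ = lam²-β (ε ▸ I₁ ▸ I₂)
  (fst · #0 · (#3 · (fst · #1) · (fst · (snd · #0))) · (#2 · (snd · #1) · (snd · (snd · #0))))

fst-snd-pair : (s : Tm Γ τ) (x : Tm Γ α) (y : Tm Γ β) →
               Γ ⨾ Δ ⊢ fst · (snd · (pair · s · (pair · x · y))) ≡' x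
fst-snd-pair s x y = ≡'-trans (·-congʳ (ax-snd _ _)) (ax-fst _ _)

snd-snd-pair : (s : Tm Γ τ) (x : Tm Γ α) (y : Tm Γ β) →
               Γ ⨾ Δ ⊢ snd · (snd · (pair · s · (pair · x · y))) ≡' y
snd-snd-pair s x y = ≡'-trans (·-congʳ (ax-snd _ _)) (ax-snd _ _)

sec⊗-inj₁ : (I₁ : Tm Γ (σ₁ ⇒ α ⇒ ι)) (I₂ : Tm Γ (σ₂ ⇒ β ⇒ ι)) (p : Tm Γ (σ₁ ⊗ σ₂))
            (D : Tm Γ β) (a : Tm Γ α) →
            Γ ⨾ Δ ⊢ sec⊗ I₁ I₂ · p · (inj₁ D · a) ≡' I₁ · (fst · p) · a
sec⊗-inj₁ I₁ I₂ p D a =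
  ≡'-trans (·-congʳ (lam-β (ε ▸ D) (pair · 𝐤 · (pair · #0 · #1)) a))
  (≡'-trans (sec⊗-β _ _ _ _)
  (≡'-trans (·-congˡ (·-cong (ax-fst _ _) (·-congʳ (fst-snd-pair _ _ _))))
  (ax-k _ _)))

sec⊗-inj₂ : (I₁ : Tm Γ (σ₁ ⇒ α ⇒ ι)) (I₂ : Tm Γ (σ₂ ⇒ β ⇒ ι)) (p : Tm Γ (σ₁ ⊗ σ₂))
            (D : Tm Γ α) (b : Tm Γ β) →
            Γ ⨾ Δ ⊢ sec⊗ I₁ I₂ · p · (inj₂ D · b) ≡' I₂ · (snd · p) · b
sec⊗-inj₂ I₁ I₂ p D b =
  ≡'-trans (·-congʳ (lam-β (ε ▸ D) (pair · (𝐤 · 𝐈) · (pair · #1 · #0)) b))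
  (≡'-trans (sec⊗-β _ _ _ _)
  (≡'-trans (·-cong (·-congˡ (ax-fst _ _)) (·-congʳ (snd-snd-pair _ _ _)))
  (≡'-trans (·-congˡ (ax-k _ _)) (𝐈-β _))))

⊗-retract : Retract σ₁ (α ⇒ ι) → Retract σ₂ (β ⇒ ι) → Retract (σ₁ ⊗ σ₂) (α ⊕ β ⇒ ι)
⊗-retract {σ₁} {α} {σ₂} {β} R₁ R₂ = record
  { i = sec⊗ i₁ i₂ ; r = r ; i-strong = i-strong ; r-strong = r-strong ; r∘i≐id = r∘i≐id }
  where
  open Retract R₁ using ()
    renaming (i to i₁; r to r₁; i-strong to i₁-strong; r-strong to r₁-strong; r-inverts-i to r₁-inverts-i₁)
  open Retract R₂ using ()
    renaming (i to i₂; r to r₂; i-strong to i₂-strong; r-strong to r₂-strong; r-inverts-i to r₂-inverts-i₂)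

  J₁ : Closed (α ⇒ α ⊕ β)
  J₁ = inj₁ (inhabitant β)

  J₂ : Closed (β ⇒ α ⊕ β)
  J₂ = inj₂ (inhabitant α)

  r : Closed ((α ⊕ β ⇒ ι) ⇒ σ₁ ⊗ σ₂)
  r = subT (ε ▸ r₁ ▸ r₂ ▸ J₁ ▸ J₂) (lam (pair · (#4 · (⌜ 𝐁 ⌝ · #0 · #2)) · (#3 · (⌜ 𝐁 ⌝ · #0 · #1))))

  r-β : (h : Tm Γ (α ⊕ β ⇒ ι)) →
        Γ ⨾ Δ ⊢ ⌜ r ⌝ · h ≡' pair · (⌜ r₁ ⌝ · (⌜ 𝐁 ⌝ · h · ⌜ J₁ ⌝)) · (⌜ r₂ ⌝ · (⌜ 𝐁 ⌝ · h · ⌜ J₂ ⌝))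
  r-β = lam-β (ε ▸ ⌜ r₁ ⌝ ▸ ⌜ r₂ ⌝ ▸ ⌜ J₁ ⌝ ▸ ⌜ J₂ ⌝)
    (pair · (#4 · (⌜ 𝐁 ⌝ · #0 · #2)) · (#3 · (⌜ 𝐁 ⌝ · #0 · #1)))

  fst-r : (h : Tm Γ (α ⊕ β ⇒ ι)) → Γ ⨾ Δ ⊢ fst · (⌜ r ⌝ · h) ≡' ⌜ r₁ ⌝ · (⌜ 𝐁 ⌝ · h · ⌜ J₁ ⌝)
  fst-r h = ≡'-trans (·-congʳ (r-β h)) (ax-fst _ _)

  snd-r : (h : Tm Γ (α ⊕ β ⇒ ι)) → Γ ⨾ Δ ⊢ snd · (⌜ r ⌝ · h) ≡' ⌜ r₂ ⌝ · (⌜ 𝐁 ⌝ · h · ⌜ J₂ ⌝)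
  snd-r h = ≡'-trans (·-congʳ (r-β h)) (ax-snd _ _)

  i-strong : UniformlyStrong (sec⊗ i₁ i₂)
  i-strong ep ep' d = ≐-ext (≐-resp-≡' ι (sec⊗-β _ _ _ _)
    (≡'⇒≐ι (·-cong
      (·-congʳ (≐⇒≡'ι (≐-app
        (UniformlyStrong-wk i₁-strong (Ext-fst (⊢-wk _ ep)) (Ext-fst (⊢-wk _ ep')) (≐-fst (⊢-wk _ d)))
        (Ext-fst (Ext-snd hyp₀)))))
      (≐⇒≡'ι (≐-app
        (UniformlyStrong-wk i₂-strong (Ext-snd (⊢-wk _ ep)) (Ext-snd (⊢-wk _ ep')) (≐-snd (⊢-wk _ d)))
        (Ext-snd (Ext-snd hyp₀))))))
    (sec⊗-β _ _ _ _))

  r-strong : UniformlyStrong r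
  r-strong eh eh' d = ≐-pair
    (≐-resp-≡' σ₁ (fst-r _)
      (r₁-strong (Ext-∘ eh (Ext-⌜⌝ J₁)) (Ext-∘ eh' (Ext-⌜⌝ J₁)) (∘-congˡ ι d (Ext-⌜⌝ J₁))) (fst-r _))
    (≐-resp-≡' σ₂ (snd-r _)
      (r₂-strong (Ext-∘ eh (Ext-⌜⌝ J₂)) (Ext-∘ eh' (Ext-⌜⌝ J₂)) (∘-congˡ ι d (Ext-⌜⌝ J₂))) (snd-r _))

  r∘i≐id : {p : Tm Γ (σ₁ ⊗ σ₂)} → Γ ⨾ Δ ⊢ Ext p → Γ ⨾ Δ ⊢ ⌜ r ⌝ · (⌜ sec⊗ i₁ i₂ ⌝ · p) ≐ p
  r∘i≐id {Γ = Γ} {Δ = Δ} {p = p} ep = ≐-pair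
    (≐-trans σ₁ (≡'⇒≐ σ₁ (fst-r _))
      (r₁-inverts-i₁ (Ext-∘ eip (Ext-⌜⌝ J₁)) (Ext-fst ep)
        (≐-ext (≡'⇒≐ι (≡'-trans (𝐁-β _ _ _) (sec⊗-inj₁ _ _ _ _ _))))))
    (≐-trans σ₂ (≡'⇒≐ σ₂ (snd-r _))
      (r₂-inverts-i₂ (Ext-∘ eip (Ext-⌜⌝ J₂)) (Ext-snd ep)
        (≐-ext (≡'⇒≐ι (≡'-trans (𝐁-β _ _ _) (sec⊗-inj₂ _ _ _ _ _))))))
    where
    eip : Γ ⨾ Δ ⊢ Ext (⌜ sec⊗ i₁ i₂ ⌝ · p)
    eip = Ext-· (Ext-⌜⌝ (sec⊗ i₁ i₂)) ep

τ-of : Ty → Ty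
τ-of ι = ι
τ-of (σ₁ ⊗ σ₂) = τ-of σ₁ ⊕ τ-of σ₂
τ-of (σ₁ ⇒ σ₂) = σ₁ ⊗ τ-of σ₂

retract : (σ : Ty) → Retract σ (τ-of σ ⇒ ι)
retract ι = ι-retract
retract (σ₁ ⊗ σ₂) = ⊗-retract (retract σ₁) (retract σ₂)
retract (σ₁ ⇒ σ₂) = ⇒-retract σ₁ (retract σ₂)

proposition3p5 : (σ : Ty) → Σ Ty (λ τ → StrongRetract σ (τ ⇒ ι))
proposition3p5 σ = τ-of σ , Retract⇒StrongRetract (retract σ)
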